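{- The function $f_{\sf TC}(n,\alpha)$, defined for integers $1\le\alpha\le n-1$, is strictly increasing in $n$ when $\alpha$ is fixed, and strictly increasing in $\alpha$ when $n$ is fixed.
   Context: For $1\le\alpha\le n$, the Turán graph $T_{n,\alpha}$ is the disjoint union of $\alpha$ cliques whose orders sum to $n$ and differ pairwise by at most one. For $1\le\alpha\le n-1$, the Turán-connected graph $TC_{n,\alpha}$ is obtained from $T_{n,\alpha}$ by choosing a vertex $v$ in a clique of size $\lceil n/\alpha\rceil$ and adding $\alpha-1$ edges joining $v$ to one vertex of each of the other cliques. $f_{\sf TC}(n,\alpha)$ is the number of stable sets (including the empty set) of $TC_{n,\alpha}$. -}

module Defs where

open import Data.Bool using (Bool; true; false; _∧_; _∨_; not)
open import Data.Nat using (ℕ; zero; suc; _%_; _≡ᵇ_; _<ᵇ_)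
open import Data.Fin using (Fin; toℕ)
open import Data.Vec using (Vec; []; _∷_; lookup)
open import Data.List using (List; []; _∷_; _++_; map; filter; length; allFin)
open import Data.Bool.ListAction using (all)
open import Data.Fin.Subset using (Subset)
open import Relation.Nullary.Decidable using (_because_)
open import Relation.Unary using (Decidable)
open import Data.Bool.Properties using (T?)

-- Concrete vertex labelling of the Turán graph T_{n,α} on vertex set Fin n:
-- vertex i lies in clique number (i mod α).  Clique c then has
-- ⌈(n - c)/α⌉ vertices, so clique sizes differ by at most one and clique 0
-- has the maximal size ⌈n/α⌉.  (α = 0 is never used.)
cliqueOf : ℕ → ℕ → ℕ
cliqueOf zero    i = i
cliqueOf (suc a) i = i % suc a

turánAdj : (n α : ℕ) → Fin n → Fin n → Bool
turánAdj n α i j = not (toℕ i ≡ᵇ toℕ j) ∧ (cliqueOf α (toℕ i) ≡ᵇ cliqueOf α (toℕ j))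

-- The hub v is vertex 0 (in clique 0, of size ⌈n/α⌉).  The α-1 added edges
-- join v to vertex c (which lies in clique c) for c = 1, …, α-1.
hubEdge : (α : ℕ) → ℕ → ℕ → Bool
hubEdge α i j = (i ≡ᵇ 0) ∧ (0 <ᵇ j) ∧ (j <ᵇ α)

tcAdj : (n α : ℕ) → Fin n → Fin n → Bool
tcAdj n α i j = turánAdj n α i j ∨ hubEdge α (toℕ i) (toℕ j) ∨ hubEdge α (toℕ j) (toℕ i)

allSubsets : (n : ℕ) → List (Subset n)
allSubsets zero    = [] ∷ []
allSubsets (suc n) = map (false ∷_) (allSubsets n) ++ map (true ∷_) (allSubsets n)

isStableTC : (n α : ℕ) → Subset n → Bool
isStableTC n α S =
  all (λ i → all (λ j → not (lookup S i ∧ lookup S j ∧ tcAdj n α i j)) (allFin n)) (allFin n)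

fTC : ℕ → ℕ → ℕ
fTC n α = length (filter (λ S → T? (isStableTC n α S)) (allSubsets n))

module Submission where

-- Label the vertices of TC_{n,α} by 0, …, n-1 as in Defs: clique c consists of
-- the vertices ≡ c (mod α) and the hub is vertex 0.  We first derive the closed
-- formula (fTC-closed)
--     f_TC(n, α) = hubOut + hubIn,
--     hubOut = s₀ · Π_{c≥1} (1 + s_c),    hubIn = Π_{c≥1} s_c,
-- where s_c is the size of clique c, counting stable sets avoiding / containing
-- the hub.  Adding a vertex to a clique raises one factor by 1, which
-- gives monotonicity in n (fTC-step-n).  For α ↦ α+1 at fixed n, TC_{n,α+1} is
-- TC_{n-Q,α} with an extra "pendant" clique of size Q = ⌊n/(α+1)⌋ attached to
-- the hub by one edge (fTC-pendant); starting from TC_{n,α}, turning the last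
-- vertex into a pendant increases the count strictly (fTC-below-pendant) and
-- moving further vertices from the full cliques into the pendant one never
-- decreases it (pendant-slide).

open import Defs
open import Data.Bool using (Bool; true; false; _∧_; _∨_; not; if_then_else_; T)
open import Data.Bool.Properties
  using (T?; ⇔→≡; ∧-conicalˡ; ∧-conicalʳ; ∨-conicalˡ; ∨-conicalʳ; not-involutive; ∨-comm;
         ∧-zeroʳ; ∧-identityʳ; ∨-zeroʳ; ∨-identityʳ)
open import Data.Bool.ListAction using (all)
open import Data.Empty using (⊥-elim)
open import Data.Fin using (Fin; toℕ) renaming (zero to fzero; suc to fsuc)
open import Data.Fin.Subset using (Subset)
open import Data.List using (List; []; _∷_; _++_; map; filter; length; allFin)
open import Data.List.Properties using (filter-++; length-++)
open import Data.List.Membership.Propositional using (_∈_)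
open import Data.List.Membership.Propositional.Properties using (∈-allFin)
open import Data.List.Relation.Unary.Any using (here; there)
open import Data.Nat
open import Data.Nat.Properties
open import Data.Nat.Tactic.RingSolver using (solve-∀)
open import Data.Nat.DivMod using (m%n<n; [m+kn]%n≡m%n; m<n⇒m%n≡m; m≡m%n+[m/n]*n)
open import Data.Product using (_×_; _,_; proj₂)
open import Data.Sum using (inj₁; inj₂)
open import Data.Vec using ([]; _∷_; lookup)
open import Function.Bundles using (mk⇔)
open import Relation.Binary.PropositionalEquality

count : {A : Set} → (A → Bool) → List A → ℕ
count p xs = length (filter (λ x → T? (p x)) xs)

count-++ : {A : Set} (p : A → Bool) (xs ys : List A) →
  count p (xs ++ ys) ≡ count p xs + count p ys
count-++ p xs ys =
  trans (cong length (filter-++ (λ x → T? (p x)) xs ys)) (length-++ (filter (λ x → T? (p x)) xs))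

count-map : {A B : Set} (p : B → Bool) (f : A → B) (xs : List A) →
  count p (map f xs) ≡ count (λ x → p (f x)) xs
count-map p f [] = refl
count-map p f (x ∷ xs) with p (f x)
... | true  = cong suc (count-map p f xs)
... | false = count-map p f xs

count-cong : {A : Set} {p q : A → Bool} → (∀ x → p x ≡ q x) → (xs : List A) → count p xs ≡ count q xs
count-cong {p = p} {q} p≗q [] = refl
count-cong {p = p} {q} p≗q (x ∷ xs) with p x | q x | p≗q x
... | true  | true  | refl = cong suc (count-cong p≗q xs)
... | false | false | refl = count-cong p≗q xs

countSubsets : (n : ℕ) → (Subset n → Bool) → ℕ
countSubsets n p = count p (allSubsets n)

countSubsets-cons : (n : ℕ) (p : Subset (suc n) → Bool) →
  countSubsets (suc n) p ≡ countSubsets n (λ S → p (false ∷ S)) + countSubsets n (λ S → p (true ∷ S))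
countSubsets-cons n p =
  trans (count-++ p (map (false ∷_) (allSubsets n)) (map (true ∷_) (allSubsets n)))
        (cong₂ _+_ (count-map p (false ∷_) (allSubsets n)) (count-map p (true ∷_) (allSubsets n)))

countSubsets-cong : (n : ℕ) {p q : Subset n → Bool} → (∀ S → p S ≡ q S) →
  countSubsets n p ≡ countSubsets n q
countSubsets-cong n p≗q = count-cong p≗q (allSubsets n)

countSubsets-guard : (n : ℕ) (b : Bool) (p : Subset n → Bool) →
  countSubsets n (λ S → b ∧ p S) ≡ (if b then countSubsets n p else 0)
countSubsets-guard n true  p = refl
countSubsets-guard n false p = none (allSubsets n)
  where
  none : (xs : List (Subset n)) → count (λ S → false) xs ≡ 0
  none []       = refl
  none (_ ∷ xs) = none xs

≡ᵇ-refl : ∀ x → (x ≡ᵇ x) ≡ true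
≡ᵇ-refl zero    = refl
≡ᵇ-refl (suc x) = ≡ᵇ-refl x

≡ᵇ-sym : ∀ x y → (x ≡ᵇ y) ≡ (y ≡ᵇ x)
≡ᵇ-sym zero    zero    = refl
≡ᵇ-sym zero    (suc y) = refl
≡ᵇ-sym (suc x) zero    = refl
≡ᵇ-sym (suc x) (suc y) = ≡ᵇ-sym x y

≡ᵇ-true⇒≡ : ∀ x y → (x ≡ᵇ y) ≡ true → x ≡ y
≡ᵇ-true⇒≡ x y e = ≡ᵇ⇒≡ x y (subst T (sym e) _)

≢⇒≡ᵇ-false : ∀ x y → x ≢ y → (x ≡ᵇ y) ≡ false
≢⇒≡ᵇ-false x y x≢y with x ≡ᵇ y in e
... | false = refl
... | true  = ⊥-elim (x≢y (≡ᵇ-true⇒≡ x y e))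

≡ᵇ-false⇒≢ : ∀ x y → (x ≡ᵇ y) ≡ false → x ≢ y
≡ᵇ-false⇒≢ x .x e refl with () ← trans (sym (≡ᵇ-refl x)) e

not-true : ∀ b → not b ≡ true → b ≡ false
not-true b e = trans (sym (not-involutive b)) (cong not e)

ind : Bool → ℕ
ind b = if b then 1 else 0

prod : ℕ → (ℕ → ℕ) → ℕ
prod zero    g = 1
prod (suc a) g = prod a g * g a

prod-cong : ∀ a {g h} → (∀ c → c < a → g c ≡ h c) → prod a g ≡ prod a h
prod-cong zero    g≗h = refl
prod-cong (suc a) g≗h = cong₂ _*_ (prod-cong a (λ c c<a → g≗h c (m<n⇒m<1+n c<a))) (g≗h a ≤-refl)

prod-mono : ∀ a {g h} → (∀ c → c < a → g c ≤ h c) → prod a g ≤ prod a h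
prod-mono zero    g≤h = ≤-refl
prod-mono (suc a) g≤h = *-mono-≤ (prod-mono a (λ c c<a → g≤h c (m<n⇒m<1+n c<a))) (g≤h a ≤-refl)

prod-pos : ∀ a {g} → (∀ c → c < a → 1 ≤ g c) → 1 ≤ prod a g
prod-pos zero    pos = ≤-refl
prod-pos (suc a) pos = *-mono-≤ (prod-pos a (λ c c<a → pos c (m<n⇒m<1+n c<a))) (pos a ≤-refl)

prod-ones : ∀ a → prod a (λ _ → 1) ≡ 1
prod-ones zero    = refl
prod-ones (suc a) rewrite prod-ones a = refl

without : (ℕ → ℕ) → ℕ → ℕ → ℕ
without g c₀ c = if c ≡ᵇ c₀ then 1 else g c

without-pos : ∀ g c₀ c → 1 ≤ g c → 1 ≤ without g c₀ c
without-pos g c₀ c pos with c ≡ᵇ c₀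
... | true  = ≤-refl
... | false = pos

without-mono : ∀ g h c₀ c → g c ≤ h c → without g c₀ c ≤ without h c₀ c
without-mono g h c₀ c g≤h with c ≡ᵇ c₀
... | true  = ≤-refl
... | false = g≤h

prod-split : ∀ a g c₀ → c₀ < a → prod a g ≡ g c₀ * prod a (without g c₀)
prod-split (suc a) g c₀ c₀<1+a with m<1+n⇒m<n∨m≡n c₀<1+a
... | inj₂ refl rewrite ≡ᵇ-refl c₀ = begin
    prod c₀ g * g c₀                    ≡⟨ cong (_* g c₀) (prod-cong c₀ others) ⟩
    prod c₀ (without g c₀) * g c₀       ≡⟨ *-comm _ (g c₀) ⟩
    g c₀ * prod c₀ (without g c₀)       ≡⟨ cong (g c₀ *_) (*-identityʳ _) ⟨
    g c₀ * (prod c₀ (without g c₀) * 1) ∎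
  where
  open ≡-Reasoning
  others : ∀ c → c < c₀ → g c ≡ without g c₀ c
  others c c<c₀ rewrite ≢⇒≡ᵇ-false c c₀ (<⇒≢ c<c₀) = refl
... | inj₁ c₀<a rewrite ≢⇒≡ᵇ-false a c₀ (λ a≡c₀ → <⇒≢ c₀<a (sym a≡c₀)) =
  trans (cong (_* g a) (prod-split a g c₀ c₀<a)) (*-assoc (g c₀) _ (g a))

prod-replace : ∀ a g g' c₀ → c₀ < a → (∀ c → c ≢ c₀ → g' c ≡ g c) →
  prod a g' ≡ g' c₀ * prod a (without g c₀)
prod-replace a g g' c₀ c₀<a g'≗g =
  trans (prod-split a g' c₀ c₀<a) (cong (g' c₀ *_) (prod-cong a (λ c _ → same c)))
  where
  same : ∀ c → without g' c₀ c ≡ without g c₀ c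
  same c with c ≡ᵇ c₀ in e
  ... | true  = refl
  ... | false = g'≗g c (≡ᵇ-false⇒≢ c c₀ e)

prod-bump : ∀ a g g' c₀ → c₀ < a → g' c₀ ≡ suc (g c₀) → (∀ c → c ≢ c₀ → g' c ≡ g c) →
  prod a g' ≡ prod a g + prod a (without g c₀)
prod-bump a g g' c₀ c₀<a bumped g'≗g = begin
  prod a g'                           ≡⟨ prod-replace a g g' c₀ c₀<a g'≗g ⟩
  g' c₀ * rest                        ≡⟨ cong (_* rest) bumped ⟩
  rest + g c₀ * rest                  ≡⟨ +-comm rest _ ⟩
  g c₀ * rest + rest                  ≡⟨ cong (_+ rest) (prod-split a g c₀ c₀<a) ⟨
  prod a g + rest                     ∎
  where
  open ≡-Reasoning
  rest = prod a (without g c₀)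

prod-drop : ∀ a g g' c₀ → c₀ < a → g' c₀ ≡ 1 → (∀ c → c ≢ c₀ → g' c ≡ g c) →
  prod a g' ≡ prod a (without g c₀)
prod-drop a g g' c₀ c₀<a dropped g'≗g =
  trans (prod-replace a g g' c₀ c₀<a g'≗g) (trans (cong (_* _) dropped) (*-identityˡ _))

prod-strict : ∀ a g h c₀ → c₀ < a → (∀ c → c < a → 1 ≤ g c) → (∀ c → c < a → g c ≤ h c) →
  g c₀ < h c₀ → prod a g < prod a h
prod-strict a g h c₀ c₀<a pos g≤h g<h = begin-strict
  prod a g                         ≡⟨ prod-split a g c₀ c₀<a ⟩
  g c₀ * rest                      <⟨ m<n+m (g c₀ * rest) (prod-pos a (λ c c<a → without-pos g c₀ c (pos c c<a))) ⟩
  suc (g c₀) * rest                ≤⟨ *-mono-≤ g<h (prod-mono a (λ c c<a → without-mono g h c₀ c (g≤h c c<a))) ⟩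
  h c₀ * prod a (without h c₀)     ≡⟨ prod-split a h c₀ c₀<a ⟨
  prod a h                         ∎
  where
  open ≤-Reasoning
  rest = prod a (without g c₀)

-- stableFrom Ad F k S reads S ⊆ Fin n as the vertex set {k + i | i ∈ S} and
-- checks it left to right: no chosen vertex may be forbidden by F, and every
-- chosen vertex forbids its Ad-neighbours for the rest of the scan.
stableFrom : {n : ℕ} → (ℕ → ℕ → Bool) → (ℕ → Bool) → ℕ → Subset n → Bool
stableFrom Ad F k []          = true
stableFrom Ad F k (false ∷ S) = stableFrom Ad F (suc k) S
stableFrom Ad F k (true ∷ S)  = not (F k) ∧ stableFrom Ad (λ x → F x ∨ Ad k x) (suc k) S

StableAvoiding : {n : ℕ} → (ℕ → ℕ → Bool) → (ℕ → Bool) → ℕ → Subset n → Set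
StableAvoiding {n} Ad F k S =
  ((i : Fin n) → lookup S i ≡ true → F (toℕ i + k) ≡ false) ×
  ((i j : Fin n) → lookup S i ≡ true → lookup S j ≡ true → Ad (toℕ i + k) (toℕ j + k) ≡ false)

module StableFrom (Ad : ℕ → ℕ → Bool) (Ad-sym : ∀ x y → Ad x y ≡ Ad y x)
                  (Ad-irr : ∀ x → Ad x x ≡ false) where

  private
    shift : ∀ {n} (i : Fin n) k → toℕ i + suc k ≡ suc (toℕ i + k)
    shift i k = +-suc (toℕ i) k

  sound : ∀ {n} F k (S : Subset n) → stableFrom Ad F k S ≡ true → StableAvoiding Ad F k S
  sound F k [] _ = (λ ()) , (λ ())
  sound F k (false ∷ S) ok =
    let (avoid , stable) = sound F (suc k) S ok in
    (λ { fzero () ; (fsuc i) i∈S → subst (λ x → F x ≡ false) (shift i k) (avoid i i∈S) }) ,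
    (λ { fzero _ () _ ; (fsuc i) fzero _ ()
       ; (fsuc i) (fsuc j) i∈S j∈S →
           subst₂ (λ x y → Ad x y ≡ false) (shift i k) (shift j k) (stable i j i∈S j∈S) })
  sound F k (true ∷ S) ok =
    let Fk = not-true (F k) (∧-conicalˡ _ _ ok)
        (avoid , stable) = sound (λ x → F x ∨ Ad k x) (suc k) S (∧-conicalʳ _ _ ok)
        notNbr : ∀ i → lookup S i ≡ true → Ad k (toℕ (fsuc i) + k) ≡ false
        notNbr i i∈S = subst (λ x → Ad k x ≡ false) (shift i k) (∨-conicalʳ _ _ (avoid i i∈S)) in
    (λ { fzero _ → Fk
       ; (fsuc i) i∈S → subst (λ x → F x ≡ false) (shift i k) (∨-conicalˡ _ _ (avoid i i∈S)) }) ,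
    (λ { fzero fzero _ _ → Ad-irr k
       ; fzero (fsuc j) _ j∈S → notNbr j j∈S
       ; (fsuc i) fzero i∈S _ → trans (Ad-sym _ k) (notNbr i i∈S)
       ; (fsuc i) (fsuc j) i∈S j∈S →
           subst₂ (λ x y → Ad x y ≡ false) (shift i k) (shift j k) (stable i j i∈S j∈S) })

  complete : ∀ {n} F k (S : Subset n) → StableAvoiding Ad F k S → stableFrom Ad F k S ≡ true
  complete F k [] _ = refl
  complete F k (false ∷ S) (avoid , stable) =
    complete F (suc k) S
      ((λ i i∈S → subst (λ x → F x ≡ false) (sym (shift i k)) (avoid (fsuc i) i∈S)) ,
       (λ i j i∈S j∈S → subst₂ (λ x y → Ad x y ≡ false) (sym (shift i k)) (sym (shift j k))
                          (stable (fsuc i) (fsuc j) i∈S j∈S)))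
  complete F k (true ∷ S) (avoid , stable) rewrite avoid fzero refl =
    complete (λ x → F x ∨ Ad k x) (suc k) S
      ((λ i i∈S → subst (λ x → F x ∨ Ad k x ≡ false) (sym (shift i k))
                    (cong₂ _∨_ (avoid (fsuc i) i∈S) (stable fzero (fsuc i) refl i∈S))) ,
       (λ i j i∈S j∈S → subst₂ (λ x y → Ad x y ≡ false) (sym (shift i k)) (sym (shift j k))
                          (stable (fsuc i) (fsuc j) i∈S j∈S)))

turánAdjℕ : ℕ → ℕ → ℕ → Bool
turánAdjℕ α x y = not (x ≡ᵇ y) ∧ (cliqueOf α x ≡ᵇ cliqueOf α y)

tcAdjℕ : ℕ → ℕ → ℕ → Bool
tcAdjℕ α x y = turánAdjℕ α x y ∨ hubEdge α x y ∨ hubEdge α y x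

tcAdjℕ-sym : ∀ α x y → tcAdjℕ α x y ≡ tcAdjℕ α y x
tcAdjℕ-sym α x y rewrite ≡ᵇ-sym x y | ≡ᵇ-sym (cliqueOf α x) (cliqueOf α y) =
  cong (turánAdjℕ α y x ∨_) (∨-comm (hubEdge α x y) (hubEdge α y x))

tcAdjℕ-irr : ∀ α x → tcAdjℕ α x x ≡ false
tcAdjℕ-irr α zero    = refl
tcAdjℕ-irr α (suc x) rewrite ≡ᵇ-refl x = refl

all-true : {A : Set} (p : A → Bool) → (∀ x → p x ≡ true) → (xs : List A) → all p xs ≡ true
all-true p holds []       = refl
all-true p holds (x ∷ xs) rewrite holds x = all-true p holds xs

all-elim : {A : Set} (p : A → Bool) (xs : List A) → all p xs ≡ true → ∀ {x} → x ∈ xs → p x ≡ true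
all-elim p (y ∷ xs) ok (here refl) = ∧-conicalˡ _ _ ok
all-elim p (y ∷ xs) ok (there x∈xs) = all-elim p xs (∧-conicalʳ _ _ ok) x∈xs

isStableTC-scan : ∀ n α (S : Subset n) → isStableTC n α S ≡ stableFrom (tcAdjℕ α) (λ _ → false) 0 S
isStableTC-scan n α S = ⇔→≡ (mk⇔ to from)
  where
  open StableFrom (tcAdjℕ α) (tcAdjℕ-sym α) (tcAdjℕ-irr α)
  shift0 : ∀ i → toℕ {n} i + 0 ≡ toℕ i
  shift0 i = +-identityʳ (toℕ i)
  to : isStableTC n α S ≡ true → stableFrom (tcAdjℕ α) (λ _ → false) 0 S ≡ true
  to ok = complete (λ _ → false) 0 S ((λ _ _ → refl) , nonadjacent)
    where
    nonadjacent : ∀ i j → lookup S i ≡ true → lookup S j ≡ true →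
                  tcAdjℕ α (toℕ i + 0) (toℕ j + 0) ≡ false
    nonadjacent i j i∈S j∈S rewrite shift0 i | shift0 j =
      let row = all-elim _ (allFin n) ok (∈-allFin i)
          entry = all-elim _ (allFin n) row (∈-allFin j) in
      not-true _ (subst₂ (λ u v → not (u ∧ v ∧ tcAdjℕ α (toℕ i) (toℕ j)) ≡ true) i∈S j∈S entry)
  from : stableFrom (tcAdjℕ α) (λ _ → false) 0 S ≡ true → isStableTC n α S ≡ true
  from ok = all-true _ (λ i → all-true _ (entry i) (allFin n)) (allFin n)
    where
    stable = proj₂ (sound (λ _ → false) 0 S ok)
    entry : ∀ i j → not (lookup S i ∧ lookup S j ∧ tcAdj n α i j) ≡ true
    entry i j with lookup S i in i∈S | lookup S j in j∈S
    ... | false | _     = refl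
    ... | true  | false = refl
    ... | true  | true
      rewrite subst₂ (λ u v → tcAdjℕ α u v ≡ false) (shift0 i) (shift0 j) (stable i j i∈S j∈S) = refl

countRange : (ℕ → Bool) → ℕ → ℕ → ℕ
countRange p k zero    = 0
countRange p k (suc n) = ind (p k) + countRange p (suc k) n

countRange-cong : ∀ {p q} k n → (∀ x → k ≤ x → p x ≡ q x) → countRange p k n ≡ countRange q k n
countRange-cong k zero    p≗q = refl
countRange-cong k (suc n) p≗q =
  cong₂ (λ b m → ind b + m) (p≗q k ≤-refl) (countRange-cong (suc k) n (λ x k<x → p≗q x (<⇒≤ k<x)))

countRange-none : ∀ p k n → (∀ x → k ≤ x → x < k + n → p x ≡ false) → countRange p k n ≡ 0
countRange-none p k zero    none = refl
countRange-none p k (suc n) none rewrite none k ≤-refl (m<m+n k z<s) =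
  countRange-none p (suc k) n (λ x k<x x<end → none x (<⇒≤ k<x) (subst (x <_) (sym (+-suc k n)) x<end))

countRange-split : ∀ p k i j → countRange p k (i + j) ≡ countRange p k i + countRange p (k + i) j
countRange-split p k zero    j rewrite +-identityʳ k = refl
countRange-split p k (suc i) j rewrite countRange-split p (suc k) i j | +-suc k i =
  sym (+-assoc (ind (p k)) _ _)

countRange-snoc : ∀ p k n → countRange p k (suc n) ≡ countRange p k n + ind (p (k + n))
countRange-snoc p k n =
  trans (cong (countRange p k) (+-comm 1 n))
        (trans (countRange-split p k n 1) (cong (countRange p k n +_) (+-identityʳ _)))

countRange-mono : ∀ p k {n n'} → n ≤ n' → countRange p k n ≤ countRange p k n'
countRange-mono p k {n} {n'} n≤n' = begin
  countRange p k n                                  ≤⟨ m≤m+n _ _ ⟩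
  countRange p k n + countRange p (k + n) (n' ∸ n)  ≡⟨ countRange-split p k n (n' ∸ n) ⟨
  countRange p k (n + (n' ∸ n))                     ≡⟨ cong (countRange p k) (m+[n∸m]≡n n≤n') ⟩
  countRange p k n'                                 ∎
  where open ≤-Reasoning

free : ℕ → (ℕ → Bool) → ℕ → ℕ → Bool
free α F c x = (cliqueOf α x ≡ᵇ c) ∧ not (F x)

-- A set of vertices k, …, k+n-1 avoiding F is stable in the Turán graph iff it
-- takes at most one free vertex from each clique, so the scan succeeds for
-- Π_c (1 + #free vertices of clique c) sets.  Ad need only agree with the Turán
-- adjacency from vertex k on.
turán-count : ∀ a' n (Ad : ℕ → ℕ → Bool) F k →
  (∀ x y → k ≤ x → x < y → Ad x y ≡ turánAdjℕ (suc a') x y) →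
  countSubsets n (stableFrom Ad F k) ≡ prod (suc a') (λ c → 1 + countRange (free (suc a') F c) k n)
turán-count a' zero    Ad F k agree = sym (prod-ones (suc a'))
turán-count a' (suc n) Ad F k agree = begin
    countSubsets (suc n) (stableFrom Ad F k)
  ≡⟨ countSubsets-cons n _ ⟩
    countSubsets n (stableFrom Ad F (suc k)) + countSubsets n (λ S → not (F k) ∧ stableFrom Ad F' (suc k) S)
  ≡⟨ cong₂ _+_ (turán-count a' n Ad F (suc k) agree') (countSubsets-guard n (not (F k)) _) ⟩
    prod a g + (if not (F k) then countSubsets n (stableFrom Ad F' (suc k)) else 0)
  ≡⟨ cong (λ m → prod a g + (if not (F k) then m else 0)) (turán-count a' n Ad F' (suc k) agree') ⟩
    prod a g + (if not (F k) then prod a g' else 0)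
  ≡⟨ choose-k (F k) refl ⟩
    prod a (λ c → 1 + countRange (free a F c) k (suc n)) ∎
  where
  open ≡-Reasoning
  a  = suc a'
  c₀ = cliqueOf a k
  c₀<a : c₀ < a
  c₀<a = m%n<n k a
  F' : ℕ → Bool
  F' x = F x ∨ Ad k x
  g g' : ℕ → ℕ
  g  c = 1 + countRange (free a F c) (suc k) n
  g' c = 1 + countRange (free a F' c) (suc k) n
  agree' : ∀ x y → suc k ≤ x → x < y → Ad x y ≡ turánAdjℕ a x y
  agree' x y k<x = agree x y (<⇒≤ k<x)

  blocked : ∀ x → suc k ≤ x → free a F' c₀ x ≡ false
  blocked x k<x with cliqueOf a x ≡ᵇ c₀ in same
  ... | false = refl
  ... | true rewrite agree k x ≤-refl k<x | ≢⇒≡ᵇ-false k x (<⇒≢ k<x)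
                   | ≡ᵇ-sym c₀ (cliqueOf a x) | same | ∨-zeroʳ (F x) = refl
  unaffected : ∀ c → c ≢ c₀ → ∀ x → suc k ≤ x → free a F' c x ≡ free a F c x
  unaffected c c≢c₀ x k<x with cliqueOf a x ≡ᵇ c in same
  ... | false = refl
  ... | true rewrite agree k x ≤-refl k<x
                   | ≢⇒≡ᵇ-false c₀ (cliqueOf a x) (λ e → c≢c₀ (trans (sym (≡ᵇ-true⇒≡ _ _ same)) (sym e)))
                   | ∧-zeroʳ (not (k ≡ᵇ x)) | ∨-identityʳ (F x) = refl

  choose-k : ∀ b → F k ≡ b → prod a g + (if not b then prod a g' else 0)
                               ≡ prod a (λ c → 1 + countRange (free a F c) k (suc n))
  choose-k true Fk =
    trans (+-identityʳ _)
          (prod-cong a (λ c _ → cong (λ b → 1 + (ind b + countRange (free a F c) (suc k) n)) (sym k-forbidden)))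
    where
    k-forbidden : ∀ {c} → free a F c k ≡ false
    k-forbidden {c} rewrite Fk = ∧-zeroʳ _
  choose-k false Fk = begin
      prod a g + prod a g'
    ≡⟨ cong (prod a g +_) (prod-drop a g g' c₀ c₀<a
         (cong suc (countRange-none _ (suc k) n (λ x k<x _ → blocked x k<x)))
         (λ c c≢c₀ → cong suc (countRange-cong (suc k) n (unaffected c c≢c₀)))) ⟩
      prod a g + prod a (without g c₀)
    ≡⟨ sym (prod-bump a g _ c₀ c₀<a k-counted others) ⟩
      prod a (λ c → 1 + countRange (free a F c) k (suc n)) ∎
    where
    k-in : ∀ c → free a F c k ≡ (c₀ ≡ᵇ c)
    k-in c rewrite Fk = ∧-identityʳ _
    k-counted : 1 + countRange (free a F c₀) k (suc n) ≡ suc (g c₀)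
    k-counted rewrite k-in c₀ | ≡ᵇ-refl c₀ = refl
    others : ∀ c → c ≢ c₀ → 1 + countRange (free a F c) k (suc n) ≡ g c
    others c c≢c₀ rewrite k-in c | ≢⇒≡ᵇ-false c₀ c (λ e → c≢c₀ (sym e)) = refl

cliqueSize : ℕ → ℕ → ℕ → ℕ
cliqueSize α m c = countRange (λ x → cliqueOf α x ≡ᵇ c) 0 m

cliqueSize-grow : ∀ α m c → c ≡ cliqueOf α m → cliqueSize α (suc m) c ≡ suc (cliqueSize α m c)
cliqueSize-grow α m c refl rewrite countRange-snoc (λ x → cliqueOf α x ≡ᵇ cliqueOf α m) 0 m
                                 | ≡ᵇ-refl (cliqueOf α m) = +-comm _ 1

cliqueSize-keep : ∀ α m c → c ≢ cliqueOf α m → cliqueSize α (suc m) c ≡ cliqueSize α m c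
cliqueSize-keep α m c c≢ rewrite countRange-snoc (λ x → cliqueOf α x ≡ᵇ c) 0 m
                               | ≢⇒≡ᵇ-false (cliqueOf α m) c (λ e → c≢ (sym e)) = +-identityʳ _

<⇒<ᵇ-true : ∀ {c r} → c < r → (c <ᵇ r) ≡ true
<⇒<ᵇ-true {zero}  {suc r} _         = refl
<⇒<ᵇ-true {suc c} {suc r} (s≤s c<r) = <⇒<ᵇ-true c<r

≤⇒<ᵇ-false : ∀ {c r} → r ≤ c → (c <ᵇ r) ≡ false
≤⇒<ᵇ-false {c}     {zero}  _         = refl
≤⇒<ᵇ-false {suc c} {suc r} (s≤s r≤c) = ≤⇒<ᵇ-false r≤c

ind-step : ∀ c r → ind (c <ᵇ r) + ind (r ≡ᵇ c) ≡ ind (c <ᵇ suc r)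
ind-step zero    zero    = refl
ind-step zero    (suc r) = refl
ind-step (suc c) zero    = refl
ind-step (suc c) (suc r) = ind-step c r

cliqueOf-round : ∀ a' q r → r < suc a' → cliqueOf (suc a') (q * suc a' + r) ≡ r
cliqueOf-round a' q r r<a =
  trans (cong (_% suc a') (+-comm (q * suc a') r)) (trans ([m+kn]%n≡m%n r q (suc a')) (m<n⇒m%n≡m r<a))

-- The first q·a + r vertices (r ≤ a) form q full rounds through the a cliques
-- plus one vertex in each clique c < r.
cliqueSize-formula : ∀ a' q r c → c < suc a' → r ≤ suc a' →
  cliqueSize (suc a') (q * suc a' + r) c ≡ q + ind (c <ᵇ r)
cliqueSize-formula a' zero    zero    c c<a _ = refl
cliqueSize-formula a' (suc q) zero    c c<a _ = begin
    cliqueSize a (suc q * a + 0) c  ≡⟨ cong (λ m → cliqueSize a m c) (trans (+-identityʳ _) (+-comm a (q * a))) ⟩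
    cliqueSize a (q * a + a) c      ≡⟨ cliqueSize-formula a' q a c c<a ≤-refl ⟩
    q + ind (c <ᵇ a)                ≡⟨ cong (λ b → q + ind b) (<⇒<ᵇ-true c<a) ⟩
    q + 1                           ≡⟨ +-comm q 1 ⟩
    suc q                           ≡⟨ +-identityʳ (suc q) ⟨
    suc q + 0                       ∎
  where
  open ≡-Reasoning
  a = suc a'
cliqueSize-formula a' q (suc r) c c<a r<a = begin
    cliqueSize a (q * a + suc r) c                                  ≡⟨ cong (λ m → cliqueSize a m c) (+-suc (q * a) r) ⟩
    cliqueSize a (suc (q * a + r)) c                                ≡⟨ countRange-snoc _ 0 (q * a + r) ⟩
    cliqueSize a (q * a + r) c + ind (cliqueOf a (q * a + r) ≡ᵇ c)  ≡⟨ cong₂ (λ m d → m + ind (d ≡ᵇ c))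
                                                                         (cliqueSize-formula a' q r c c<a (<⇒≤ r<a))
                                                                         (cliqueOf-round a' q r r<a) ⟩
    q + ind (c <ᵇ r) + ind (r ≡ᵇ c)                                 ≡⟨ +-assoc q _ _ ⟩
    q + (ind (c <ᵇ r) + ind (r ≡ᵇ c))                               ≡⟨ cong (q +_) (ind-step c r) ⟩
    q + ind (c <ᵇ suc r)                                            ∎
  where
  open ≡-Reasoning
  a = suc a'

cliqueSize-lower : ∀ a' q r m c → c < suc a' → r ≤ suc a' → q * suc a' + r ≤ m →
  q + ind (c <ᵇ r) ≤ cliqueSize (suc a') m c
cliqueSize-lower a' q r m c c<a r≤a bound =
  subst (_≤ cliqueSize (suc a') m c) (cliqueSize-formula a' q r c c<a r≤a) (countRange-mono _ 0 bound)

AtLeast : ℕ → ℕ → ℕ → Set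
AtLeast α m s = ∀ c → c < α → s ≤ cliqueSize α m c

atLeast : ∀ a' q m → q * suc a' ≤ m → AtLeast (suc a') m q
atLeast a' q m bound c c<a =
  subst (_≤ cliqueSize (suc a') m c) (+-identityʳ q)
        (cliqueSize-lower a' q 0 m c c<a z≤n (subst (_≤ m) (sym (+-identityʳ _)) bound))

-- A stable set of TC_{m,α} avoiding the hub 0 takes at
-- most one of the other vertices of each clique; one containing the hub takes
-- nothing else from clique 0 and, from clique c ≥ 1, at most one vertex other
-- than the hub's neighbour c.  These are the per-clique numbers of choices.
hubOutFactor : ℕ → ℕ → ℕ → ℕ
hubOutFactor α m zero    = cliqueSize α m 0
hubOutFactor α m (suc c) = 1 + cliqueSize α m (suc c)

hubInFactor : ℕ → ℕ → ℕ → ℕ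
hubInFactor α m zero    = 1
hubInFactor α m (suc c) = cliqueSize α m (suc c)

hubOut hubIn : ℕ → ℕ → ℕ
hubOut α m = prod α (hubOutFactor α m)
hubIn  α m = prod α (hubInFactor α m)

fTC-closed : ∀ a' n → suc a' ≤ n → fTC n (suc a') ≡ hubOut (suc a') n + hubIn (suc a') n
fTC-closed a' (suc n₁) (s≤s a'≤n₁) = begin
    fTC (suc n₁) a
  ≡⟨ countSubsets-cong (suc n₁) (isStableTC-scan (suc n₁) a) ⟩
    countSubsets (suc n₁) (stableFrom (tcAdjℕ a) nothing 0)
  ≡⟨ countSubsets-cons n₁ _ ⟩
    countSubsets n₁ (stableFrom (tcAdjℕ a) nothing 1) + countSubsets n₁ (stableFrom (tcAdjℕ a) hubNbr 1)
  ≡⟨ cong₂ _+_ (turán-count a' n₁ (tcAdjℕ a) nothing 1 off-hub)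
               (turán-count a' n₁ (tcAdjℕ a) hubNbr 1 off-hub) ⟩
    prod a (λ c → 1 + countRange (free a nothing c) 1 n₁) + prod a (λ c → 1 + countRange (free a hubNbr c) 1 n₁)
  ≡⟨ cong₂ _+_ (prod-cong a (λ c _ → out-factor c)) (prod-cong a in-factor) ⟩
    hubOut a (suc n₁) + hubIn a (suc n₁) ∎
  where
  open ≡-Reasoning
  a = suc a'
  nothing hubNbr : ℕ → Bool
  nothing _ = false
  hubNbr x  = false ∨ tcAdjℕ a 0 x

  off-hub : ∀ x y → 1 ≤ x → x < y → tcAdjℕ a x y ≡ turánAdjℕ a x y
  off-hub (suc x) (suc y) _ _ = ∨-identityʳ _

  out-factor : ∀ c → 1 + countRange (free a nothing c) 1 n₁ ≡ hubOutFactor a (suc n₁) c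
  out-factor zero    = cong suc (countRange-cong 1 n₁ (λ x _ → ∧-identityʳ _))
  out-factor (suc c) = cong suc (countRange-cong 1 n₁ (λ x _ → ∧-identityʳ _))

  in-factor : ∀ c → c < a → 1 + countRange (free a hubNbr c) 1 n₁ ≡ hubInFactor a (suc n₁) c
  in-factor zero _ = cong suc (countRange-none _ 1 n₁ (λ x 1≤x _ → clique0-blocked x 1≤x))
    where
    clique0-blocked : ∀ x → 1 ≤ x → free a hubNbr 0 x ≡ false
    clique0-blocked (suc x) _ with cliqueOf a (suc x) ≡ᵇ 0 in same
    ... | false = refl
    ... | true rewrite ≡ᵇ-sym 0 (cliqueOf a (suc x)) | same = refl
  in-factor (suc c) c<a = begin
      1 + countRange p 1 n₁
    ≡⟨ cong (λ m → 1 + countRange p 1 m) (sym a'+d≡n₁) ⟩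
      1 + countRange p 1 (a' + d)
    ≡⟨ cong suc (countRange-split p 1 a' d) ⟩
      1 + (countRange p 1 a' + countRange p a d)
    ≡⟨ cong₂ (λ u v → 1 + (u + v)) (countRange-none p 1 a' near-hub) (countRange-cong a d far-from-hub) ⟩
      1 + countRange inClique a d
    ≡⟨ cong (_+ countRange inClique a d) (cliqueSize-formula a' 1 0 (suc c) c<a z≤n) ⟨
      cliqueSize a (1 * a + 0) (suc c) + countRange inClique a d
    ≡⟨ cong (λ m → cliqueSize a m (suc c) + countRange inClique a d) (trans (+-identityʳ _) (*-identityˡ a)) ⟩
      cliqueSize a a (suc c) + countRange inClique a d
    ≡⟨ countRange-split inClique 0 a d ⟨
      cliqueSize a (suc (a' + d)) (suc c)
    ≡⟨ cong (λ m → cliqueSize a (suc m) (suc c)) a'+d≡n₁ ⟩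
      cliqueSize a (suc n₁) (suc c) ∎
    where
    d = n₁ ∸ a'
    a'+d≡n₁ : a' + d ≡ n₁
    a'+d≡n₁ = m+[n∸m]≡n a'≤n₁
    inClique : ℕ → Bool
    inClique x = cliqueOf a x ≡ᵇ suc c
    p = free a hubNbr (suc c)
    -- For x ≥ 1 in clique c+1 ≠ 0, the only possible edge to the hub is the added one (x < α).
    free-hub : ∀ x → 1 ≤ x → p x ≡ inClique x ∧ not (x <ᵇ a)
    free-hub (suc x) _ with inClique (suc x) in same
    ... | false = refl
    ... | true rewrite ≡ᵇ-sym 0 (cliqueOf a (suc x))
                     | ≢⇒≡ᵇ-false (cliqueOf a (suc x)) 0 (λ e → 0≢1+n (trans (sym e) (≡ᵇ-true⇒≡ _ _ same)))
                     | ∨-identityʳ (suc x <ᵇ a) = refl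
    near-hub : ∀ x → 1 ≤ x → x < 1 + a' → p x ≡ false
    near-hub x 1≤x x<a rewrite free-hub x 1≤x | <⇒<ᵇ-true x<a = ∧-zeroʳ _
    far-from-hub : ∀ x → a ≤ x → p x ≡ inClique x
    far-from-hub x a≤x rewrite free-hub x (≤-trans (s≤s z≤n) a≤x) | ≤⇒<ᵇ-false a≤x = ∧-identityʳ _

-- Adding vertex m to TC_{m,α}.  Its clique c₀ = cliqueOf α m grows, so hubOut
-- gains outRest, the product of its other factors, and hubIn gains inGain:
-- likewise the product of its other factors if c₀ ≠ 0, and nothing if c₀ = 0.
outRest : ℕ → ℕ → ℕ
outRest α m = prod α (without (hubOutFactor α m) (cliqueOf α m))

inGainAt : ℕ → ℕ → ℕ → ℕ
inGainAt α m zero    = 0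
inGainAt α m (suc c) = prod α (without (hubInFactor α m) (suc c))

inGain : ℕ → ℕ → ℕ
inGain α m = inGainAt α m (cliqueOf α m)

outFactor-grow : ∀ α m c → c ≡ cliqueOf α m → hubOutFactor α (suc m) c ≡ suc (hubOutFactor α m c)
outFactor-grow α m zero    e = cliqueSize-grow α m 0 e
outFactor-grow α m (suc c) e = cong suc (cliqueSize-grow α m (suc c) e)

outFactor-keep : ∀ α m c → c ≢ cliqueOf α m → hubOutFactor α (suc m) c ≡ hubOutFactor α m c
outFactor-keep α m zero    c≢ = cliqueSize-keep α m 0 c≢
outFactor-keep α m (suc c) c≢ = cong suc (cliqueSize-keep α m (suc c) c≢)

inFactor-keep : ∀ α m c → c ≢ cliqueOf α m → hubInFactor α (suc m) c ≡ hubInFactor α m c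
inFactor-keep α m zero    c≢ = refl
inFactor-keep α m (suc c) c≢ = cliqueSize-keep α m (suc c) c≢

hubOut-succ : ∀ a' m → hubOut (suc a') (suc m) ≡ hubOut (suc a') m + outRest (suc a') m
hubOut-succ a' m = prod-bump (suc a') _ _ (cliqueOf (suc a') m) (m%n<n m (suc a'))
                     (outFactor-grow (suc a') m _ refl) (outFactor-keep (suc a') m)

hubIn-succ : ∀ a' m → hubIn (suc a') (suc m) ≡ hubIn (suc a') m + inGain (suc a') m
hubIn-succ a' m = at (cliqueOf a m) refl
  where
  a = suc a'
  at : ∀ c₀ → c₀ ≡ cliqueOf a m → hubIn a (suc m) ≡ hubIn a m + inGainAt a m c₀
  at zero    c₀≡ = trans (prod-cong a (λ c _ → unchanged c)) (sym (+-identityʳ _))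
    where
    unchanged : ∀ c → hubInFactor a (suc m) c ≡ hubInFactor a m c
    unchanged zero    = refl
    unchanged (suc c) = inFactor-keep a m (suc c) (λ e → 0≢1+n (trans c₀≡ (sym e)))
  at (suc c) c₀≡ = prod-bump a _ _ (suc c) (subst (_< a) (sym c₀≡) (m%n<n m a))
                     (cliqueSize-grow a m (suc c) c₀≡)
                     (λ c' c'≢ → inFactor-keep a m c' (λ e → c'≢ (trans e (sym c₀≡))))

hubOut-split : ∀ a' m →
  hubOut (suc a') m ≡ hubOutFactor (suc a') m (cliqueOf (suc a') m) * outRest (suc a') m
hubOut-split a' m = prod-split (suc a') _ (cliqueOf (suc a') m) (m%n<n m (suc a'))

inGain-weight : ∀ a' m →
  inGain (suc a') m * cliqueSize (suc a') m (cliqueOf (suc a') m) ≤ hubIn (suc a') m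
inGain-weight a' m = at (cliqueOf a m) refl
  where
  a = suc a'
  at : ∀ c₀ → c₀ ≡ cliqueOf a m → inGainAt a m c₀ * cliqueSize a m c₀ ≤ hubIn a m
  at zero    _   = z≤n
  at (suc c) c₀≡ = ≤-reflexive (trans (*-comm (inGainAt a m (suc c)) _)
                       (sym (prod-split a (hubInFactor a m) (suc c) (subst (_< a) (sym c₀≡) (m%n<n m a)))))

outFactor-size : ∀ α m c → cliqueSize α m c ≤ hubOutFactor α m c
outFactor-size α m zero    = ≤-refl
outFactor-size α m (suc c) = n≤1+n _

outRest-pos : ∀ a' m → AtLeast (suc a') m 1 → 1 ≤ outRest (suc a') m
outRest-pos a' m nonempty =
  prod-pos (suc a') (λ c c<a → without-pos (hubOutFactor (suc a') m) _ c
                                 (≤-trans (nonempty c c<a) (outFactor-size _ m c)))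

-- With all cliques non-empty and clique 0 of size ≥ 2, inGain < outRest: the
-- factor at clique 0 is 1 in inGain but cliqueSize ≥ 2 in outRest.
inGain<outRest : ∀ a' m → AtLeast (suc a') m 1 → 2 ≤ cliqueSize (suc a') m 0 →
  inGain (suc a') m < outRest (suc a') m
inGain<outRest a' m nonempty big0 = at (cliqueOf a m) refl
  where
  a = suc a'
  at : ∀ c₀ → c₀ ≡ cliqueOf a m → inGainAt a m c₀ < prod a (without (hubOutFactor a m) (cliqueOf a m))
  at zero    _   = outRest-pos a' m nonempty
  at (suc c) c₀≡ rewrite sym c₀≡ = prod-strict a _ _ 0 z<s in-pos in≤out big0
    where
    in-pos : ∀ c' → c' < a → 1 ≤ without (hubInFactor a m) (suc c) c'
    in-pos zero     _    = ≤-refl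
    in-pos (suc c') c'<a = without-pos (hubInFactor a m) (suc c) (suc c') (nonempty (suc c') c'<a)
    in≤out : ∀ c' → c' < a → without (hubInFactor a m) (suc c) c' ≤ without (hubOutFactor a m) (suc c) c'
    in≤out zero     _ = ≤-trans (n≤1+n 1) big0
    in≤out (suc c') _ = without-mono (hubInFactor a m) (hubOutFactor a m) (suc c) (suc c') (n≤1+n _)

-- Monotonicity in n: the new vertex strictly enlarges hubOut and does not shrink hubIn.
fTC-step-n : ∀ a' m → suc a' ≤ m → fTC m (suc a') < fTC (suc m) (suc a')
fTC-step-n a' m a≤m = begin-strict
    fTC m a
  ≡⟨ fTC-closed a' m a≤m ⟩
    hubOut a m + hubIn a m
  <⟨ +-mono-<-≤ (m<m+n (hubOut a m) (outRest-pos a' m nonempty)) (m≤m+n (hubIn a m) (inGain a m)) ⟩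
    (hubOut a m + outRest a m) + (hubIn a m + inGain a m)
  ≡⟨ cong₂ _+_ (hubOut-succ a' m) (hubIn-succ a' m) ⟨
    hubOut a (suc m) + hubIn a (suc m)
  ≡⟨ fTC-closed a' (suc m) (m≤n⇒m≤1+n a≤m) ⟨
    fTC (suc m) a ∎
  where
  open ≤-Reasoning
  a = suc a'
  nonempty : AtLeast a m 1
  nonempty = atLeast a' 1 m (subst (_≤ m) (sym (*-identityˡ a)) a≤m)

-- withPendant α m t (t ≥ 1) counts the stable sets of TC_{m,α} plus an extra
-- clique of t vertices, one of them joined to the hub: t+1 choices there when
-- the hub is not taken, t choices when it is.  When the extra clique has the
-- size of the others, this is TC_{m+t,α+1}; see fTC-pendant below.
withPendant : ℕ → ℕ → ℕ → ℕ
withPendant α m t = hubOut α m * suc t + hubIn α m * t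

-- Moving one vertex from a clique of size ≥ t+1 into the extra clique of size t
-- does not decrease the count.
pendant-shift : ∀ a' m t → AtLeast (suc a') m (suc t) →
  withPendant (suc a') (suc m) t ≤ withPendant (suc a') m (suc t)
pendant-shift a' m t big = begin
    withPendant a (suc m) t
  ≡⟨ cong₂ (λ u v → u * suc t + v * t) (hubOut-succ a' m) (hubIn-succ a' m) ⟩
    (out + outRest a m) * suc t + (inn + inGain a m) * t
  ≡⟨ regroup out inn (outRest a m) (inGain a m) t ⟩
    withPendant a m t + (outRest a m * suc t + inGain a m * t)
  ≤⟨ +-monoʳ-≤ (withPendant a m t) (+-mono-≤ out-part in-part) ⟩
    withPendant a m t + (out + inn)
  ≡⟨ grow-t out inn t ⟨
    withPendant a m (suc t) ∎
  where
  open ≤-Reasoning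
  a   = suc a'
  c₀  = cliqueOf a m
  out = hubOut a m
  inn = hubIn a m
  regroup : ∀ o i r g t → (o + r) * suc t + (i + g) * t ≡ (o * suc t + i * t) + (r * suc t + g * t)
  regroup = solve-∀
  grow-t : ∀ o i t → o * suc (suc t) + i * suc t ≡ (o * suc t + i * t) + (o + i)
  grow-t = solve-∀
  big-c₀ : suc t ≤ cliqueSize a m c₀
  big-c₀ = big c₀ (m%n<n m a)
  out-part : outRest a m * suc t ≤ out
  out-part = begin
    outRest a m * suc t                     ≡⟨ *-comm (outRest a m) (suc t) ⟩
    suc t * outRest a m                     ≤⟨ *-monoˡ-≤ (outRest a m) (≤-trans big-c₀ (outFactor-size a m c₀)) ⟩
    hubOutFactor a m c₀ * outRest a m       ≡⟨ hubOut-split a' m ⟨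
    out                                     ∎
  in-part : inGain a m * t ≤ inn
  in-part = ≤-trans (*-monoʳ-≤ (inGain a m) (≤-trans (n≤1+n t) big-c₀)) (inGain-weight a' m)

atLeast-mono : ∀ α {m m' s s'} → m ≤ m' → s' ≤ s → AtLeast α m s → AtLeast α m' s'
atLeast-mono α m≤m' s'≤s big c c<α = ≤-trans s'≤s (≤-trans (big c c<α) (countRange-mono _ 0 m≤m'))

pendant-slide : ∀ a' j t m → AtLeast (suc a') m (t + j) →
  withPendant (suc a') (m + j) t ≤ withPendant (suc a') m (t + j)
pendant-slide a' zero t m _ rewrite +-identityʳ m | +-identityʳ t = ≤-refl
pendant-slide a' (suc j) t m big = begin
    withPendant a (m + suc j) t    ≡⟨ cong (λ x → withPendant a x t) (+-suc m j) ⟩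
    withPendant a (suc (m + j)) t  ≤⟨ pendant-shift a' (m + j) t (atLeast-mono a (m≤m+n m j) t<s big) ⟩
    withPendant a (m + j) (suc t)  ≤⟨ pendant-slide a' j (suc t) m (atLeast-mono a {m} ≤-refl reindex big) ⟩
    withPendant a m (suc t + j)    ≡⟨ cong (withPendant a m) (+-suc t j) ⟨
    withPendant a m (t + suc j)    ∎
  where
  open ≤-Reasoning
  a = suc a'
  reindex : suc t + j ≤ t + suc j
  reindex = ≤-reflexive (sym (+-suc t j))
  t<s : suc t ≤ t + suc j
  t<s = ≤-trans (s≤s (m≤m+n t j)) reindex

-- Making the last vertex a pendant (t = 1) strictly increases the count, as
-- long as all cliques are non-empty and clique 0 (the hub's) has ≥ 2 vertices.
fTC-below-pendant : ∀ a' m → AtLeast (suc a') m 1 → 2 ≤ cliqueSize (suc a') m 0 →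
  hubOut (suc a') (suc m) + hubIn (suc a') (suc m) < withPendant (suc a') m 1
fTC-below-pendant a' m nonempty big0 = begin-strict
    hubOut a (suc m) + hubIn a (suc m)
  ≡⟨ cong₂ _+_ (hubOut-succ a' m) (hubIn-succ a' m) ⟩
    (out + outRest a m) + (inn + inGain a m)
  ≡⟨ regroup out inn (outRest a m) (inGain a m) ⟩
    (out + inn) + (outRest a m + inGain a m)
  <⟨ +-monoʳ-< (out + inn) gains<out ⟩
    (out + inn) + out
  ≡⟨ pendant-one out inn ⟨
    withPendant a m 1 ∎
  where
  open ≤-Reasoning
  a   = suc a'
  c₀  = cliqueOf a m
  out = hubOut a m
  inn = hubIn a m
  regroup : ∀ o i r g → (o + r) + (i + g) ≡ (o + i) + (r + g)
  regroup = solve-∀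
  pendant-one : ∀ o i → o * 2 + i * 1 ≡ (o + i) + o
  pendant-one = solve-∀
  two≤factor : ∀ c → c < a → 2 ≤ hubOutFactor a m c
  two≤factor zero    _   = big0
  two≤factor (suc c) c<a = s≤s (nonempty (suc c) c<a)
  gains<out : outRest a m + inGain a m < out
  gains<out = begin-strict
    outRest a m + inGain a m            <⟨ +-monoʳ-< (outRest a m) (inGain<outRest a' m nonempty big0) ⟩
    outRest a m + outRest a m           ≡⟨ cong (outRest a m +_) (+-identityʳ _) ⟨
    2 * outRest a m                     ≤⟨ *-monoˡ-≤ (outRest a m) (two≤factor c₀ (m%n<n m a)) ⟩
    hubOutFactor a m c₀ * outRest a m   ≡⟨ hubOut-split a' m ⟨
    out                                 ∎

-- Write n = Q·(α+1) + R with R ≤ α.  The first α cliques of T_{n,α+1} have the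
-- sizes of the cliques of T_{Q·α+R,α} and the last one has Q vertices, joined to
-- the hub by one edge: TC_{n,α+1} is TC_{Q·α+R,α} with a pendant clique of size Q.
fTC-pendant : ∀ a' Q R → R ≤ suc a' →
  hubOut (suc (suc a')) (Q * suc (suc a') + R) + hubIn (suc (suc a')) (Q * suc (suc a') + R)
    ≡ withPendant (suc a') (Q * suc a' + R) Q
fTC-pendant a' Q R R≤a =
  cong₂ _+_ (cong₂ _*_ (prod-cong a out-same) (cong suc last)) (cong₂ _*_ (prod-cong a in-same) last)
  where
  a = suc a'
  n = Q * suc a + R
  m = Q * a + R
  same-size : ∀ c → c < a → cliqueSize (suc a) n c ≡ cliqueSize a m c
  same-size c c<a = trans (cliqueSize-formula a Q R c (m<n⇒m<1+n c<a) (m≤n⇒m≤1+n R≤a))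
                          (sym (cliqueSize-formula a' Q R c c<a R≤a))
  last : cliqueSize (suc a) n a ≡ Q
  last = trans (cliqueSize-formula a Q R a ≤-refl (m≤n⇒m≤1+n R≤a))
               (trans (cong (λ b → Q + ind b) (≤⇒<ᵇ-false R≤a)) (+-identityʳ Q))
  out-same : ∀ c → c < a → hubOutFactor (suc a) n c ≡ hubOutFactor a m c
  out-same zero    c<a = same-size 0 c<a
  out-same (suc c) c<a = cong suc (same-size (suc c) c<a)
  in-same : ∀ c → c < a → hubInFactor (suc a) n c ≡ hubInFactor a m c
  in-same zero    _   = refl
  in-same (suc c) c<a = same-size (suc c) c<a

-- Monotonicity in α, for n = (Q'+1)·(α+1) + R ≥ α+2: from TC_{n,α}, make the last
-- vertex a pendant (strict gain), then move Q'-1 more vertices into the pendant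
-- clique (no loss), arriving at TC_{n,α+1}.
fTC-step-α-divided : ∀ a' Q' R → R ≤ suc a' → let n = suc Q' * suc (suc a') + R in
  suc (suc (suc a')) ≤ n → fTC n (suc a') < fTC n (suc (suc a'))
fTC-step-α-divided a' Q' R R≤a big = begin-strict
    fTC n a                                           ≡⟨ fTC-closed a' n (≤-trans (n≤1+n a) a<n) ⟩
    hubOut a n + hubIn a n                            ≡⟨ cong (λ x → hubOut a x + hubIn a x) n≡ ⟩
    hubOut a (suc (m + Q')) + hubIn a (suc (m + Q'))  <⟨ fTC-below-pendant a' (m + Q') nonempty big0 ⟩
    withPendant a (m + Q') 1                          ≤⟨ pendant-slide a' Q' 1 m full ⟩
    withPendant a m (1 + Q')                          ≡⟨ fTC-pendant a' (suc Q') R R≤a ⟨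
    hubOut (suc a) n + hubIn (suc a) n                ≡⟨ fTC-closed (suc a') n a<n ⟨
    fTC n (suc a)                                     ∎
  where
  open ≤-Reasoning
  a = suc a'
  n = suc Q' * suc a + R
  m = suc Q' * a + R
  n≡ : n ≡ suc (m + Q')
  n≡ = split Q' a R
    where
    split : ∀ Q' a R → suc Q' * suc a + R ≡ suc ((suc Q' * a + R) + Q')
    split = solve-∀
  a<n : suc a ≤ n
  a<n = ≤-trans (n≤1+n _) big
  a<n-1 : suc a ≤ m + Q'
  a<n-1 = ≤-pred (subst (suc (suc a) ≤_) n≡ big)
  nonempty : AtLeast a (m + Q') 1
  nonempty = atLeast a' 1 (m + Q') (subst (_≤ m + Q') (sym (*-identityˡ a)) (≤-trans (n≤1+n a) a<n-1))
  big0 : 2 ≤ cliqueSize a (m + Q') 0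
  big0 = cliqueSize-lower a' 1 1 (m + Q') 0 z<s (s≤s z≤n)
           (subst (_≤ m + Q') (trans (+-comm 1 a) (cong (_+ 1) (sym (*-identityˡ a)))) a<n-1)
  full : AtLeast a m (1 + Q')
  full = atLeast a' (suc Q') m (m≤m+n _ R)

fTC-step-α : ∀ a' n → suc (suc a') ≤ n ∸ 1 → fTC n (suc a') < fTC n (suc (suc a'))
fTC-step-α a' (suc n') big with suc n' / suc (suc a') | m≡m%n+[m/n]*n (suc n') (suc (suc a'))
... | zero   | n≡R+0 = ⊥-elim (<⇒≱ (<-≤-trans (m%n<n (suc n') (suc (suc a'))) (m≤n⇒m≤1+n big))
                                    (≤-reflexive (trans n≡R+0 (+-identityʳ _))))
... | suc Q' | n≡ = subst (λ x → fTC x (suc a') < fTC x (suc (suc a'))) (sym (trans n≡ (+-comm R _)))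
                      (fTC-step-α-divided a' Q' R (≤-pred (m%n<n (suc n') (suc (suc a'))))
                        (subst (suc (suc (suc a')) ≤_) (trans n≡ (+-comm R _)) (s≤s big)))
  where
  R = suc n' % suc (suc a')

steps⇒increasing : (f : ℕ → ℕ) (lo hi : ℕ) → (∀ k → lo ≤ k → suc k ≤ hi → f k < f (suc k)) →
  ∀ {n m} → lo ≤ n → n < m → m ≤ hi → f n < f m
steps⇒increasing f lo hi step {n} {suc m} lo≤n n<1+m 1+m≤hi with m≤n⇒m<n∨m≡n (≤-pred n<1+m)
... | inj₂ refl = step n lo≤n 1+m≤hi
... | inj₁ n<m  = <-trans (steps⇒increasing f lo hi step lo≤n n<m (<⇒≤ 1+m≤hi))
                          (step m (≤-trans lo≤n (<⇒≤ n<m)) 1+m≤hi)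

proposition1 : ((α n m : ℕ) → 1 ≤ α → α ≤ n ∸ 1 → n < m → fTC n α < fTC m α)
    × ((n α β : ℕ) → 1 ≤ α → α < β → β ≤ n ∸ 1 → fTC n α < fTC n β)
proposition1 = increasing-in-n , increasing-in-α
  where
  increasing-in-n : (α n m : ℕ) → 1 ≤ α → α ≤ n ∸ 1 → n < m → fTC n α < fTC m α
  increasing-in-n (suc a') n m _ α≤n-1 n<m =
    steps⇒increasing (λ k → fTC k (suc a')) (suc a') m (λ k α≤k _ → fTC-step-n a' k α≤k)
      (≤-trans α≤n-1 (m∸n≤m n 1)) n<m ≤-refl
  increasing-in-α : (n α β : ℕ) → 1 ≤ α → α < β → β ≤ n ∸ 1 → fTC n α < fTC n β
  increasing-in-α n α β 1≤α α<β β≤n-1 = steps⇒increasing (fTC n) 1 (n ∸ 1) step 1≤α α<β β≤n-1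
    where
    step : ∀ k → 1 ≤ k → suc k ≤ n ∸ 1 → fTC n k < fTC n (suc k)
    step (suc a') _ = fTC-step-α a' n
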